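{- Let $G$ be a graph with $\mathrm{diam}(G)=2$. Then there are at most $\left\lfloor\left(\frac{|G|}{2}\right)^2\right\rfloor$ pairs $(u,v)\in V_p$ for which $r_w(u,v)=\frac{1}{|G|}$ for every $w\in V(G)$.
   Context: All graphs are finite, simple, connected and have at least two vertices; $d(x,y)$ is the shortest-path distance, $\mathrm{diam}(G)$ the maximum distance, and $|G|$ the number of vertices. A vertex $w$ resolves two vertices $u,v$ if $d(u,w)\neq d(v,w)$. $V_p$ is the set of all unordered pairs $(u,v)$ of distinct vertices. For $(u,v)\in V_p$, $R(u,v)=\{x\in V(G): x \text{ resolves } u,v\}$, and for $w\in V(G)$ the resolving share is $r_w(u,v)=1/|R(u,v)|$ if $w$ resolves $u,v$, and $0$ otherwise. -}

module Defs where

open import Data.Nat as ℕ using (ℕ; zero; suc; _≤_; _<_; NonZero)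
open import Data.Fin as Fin using (Fin)
open import Data.Fin.Properties as FinP using ()
open import Data.Bool using (Bool; true; false; _∧_; _∨_; not; if_then_else_)
open import Data.List as List using (List; []; _∷_; length; filter; map; concatMap)
open import Data.Bool.ListAction using (any)
import Data.Bool
open import Data.List.Base using (allFin)
open import Data.Product using (_×_; _,_; ∃; ∃-syntax; proj₁; proj₂)
open import Data.Integer using (+_)
open import Data.Rational as ℚ using (ℚ; _/_; 0ℚ)
open import Relation.Nullary using (¬_; Dec; yes; no)
open import Relation.Nullary.Decidable using (⌊_⌋)
open import Relation.Binary.PropositionalEquality using (_≡_)
open import Relation.Unary using (Decidable)

record Graph (n : ℕ) : Set where
  field
    adj      : Fin n → Fin n → Bool
    adj-sym  : ∀ x y → adj x y ≡ adj y x
    adj-irr  : ∀ x → adj x x ≡ false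
open Graph public

module _ {n : ℕ} (G : Graph n) where

  reach : ℕ → Fin n → Fin n → Bool
  reach zero    x y = ⌊ x Fin.≟ y ⌋
  reach (suc k) x y = reach k x y ∨ any (λ z → adj G x z ∧ reach k z y) (allFin n)

  Connected : Set
  Connected = ∀ x y → ∃[ k ] reach k x y ≡ true

  -- least k < b with p k = true (b if none)
  private
    least : ℕ → (ℕ → Bool) → ℕ
    least zero    p = zero
    least (suc b) p = if p zero then zero else suc (least b (λ k → p (suc k)))

  -- shortest-path distance d(x,y); for connected graphs a shortest walk
  -- has length < n, so the search bound n suffices.
  dist : Fin n → Fin n → ℕ
  dist x y = least n (λ k → reach k x y)

  Diam2 : Set
  Diam2 = (∀ x y → dist x y ≤ 2) × (∃[ x ] ∃[ y ] dist x y ≡ 2)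

  resolves : Fin n → Fin n → Fin n → Bool
  resolves w u v = not ⌊ dist u w ℕ.≟ dist v w ⌋

  resolvingCount : Fin n → Fin n → ℕ
  resolvingCount u v = length (filter (λ w → resolves w u v Data.Bool.≟ true) (allFin n))

  -- resolving share r_w(u,v)  (R(u,v) is never empty for u ≠ v; the 0
  -- branch for an empty R is never used on pairs of distinct vertices)
  share : Fin n → Fin n → Fin n → ℚ
  share w u v with resolves w u v | resolvingCount u v
  ... | false | _     = 0ℚ
  ... | true  | zero  = 0ℚ
  ... | true  | suc m = + 1 / suc m

  -- V_p : all unordered pairs of distinct vertices, listed as (u , v) with u < v
  Vp : List (Fin n × Fin n)
  Vp = concatMap (λ u → map (u ,_) (filter (λ v → u Fin.<? v) (allFin n))) (allFin n)

  AllSharesOneOverN : .{{NonZero n}} → Fin n × Fin n → Set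
  AllSharesOneOverN (u , v) = ∀ w → share w u v ≡ + 1 / n

  allSharesOneOverN? : .{{_ : NonZero n}} → Decidable AllSharesOneOverN
  allSharesOneOverN? (u , v) = Data.Fin.Properties.all? (λ w → share w u v ℚ.≟ + 1 / n)
    where import Data.Fin.Properties

  countOneOverN : .{{NonZero n}} → ℕ
  countOneOverN = length (filter allSharesOneOverN? Vp)

module Submission where

-- Call a pair (u , v) fully resolved when every vertex w has
-- d(u,w) ≠ d(v,w).  A pair counted by countOneOverN has all resolving
-- shares equal to 1/|G| ≠ 0, so it is fully resolved.  In a graph of
-- diameter at most 2:
--   * a fully resolved pair is an edge (otherwise a common neighbour of
--     u and v, or v itself, fails to resolve it);
--   * if (u₀ , v₀) is fully resolved, every non-neighbour of v₀ is a
--     neighbour of u₀, hence for any fully resolved pair (x , y) exactly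
--     one of x, y is a neighbour of v₀ (v₀, resp. u₀, resolves it).
-- So once a single pair is counted, all counted pairs cross the cut
-- (N(v₀), complement), and a cut with k and m vertices on its sides is
-- crossed by k·m ≤ ⌊(k+m)²/4⌋ pairs.  Only the bound d(x,y) ≤ 2 is used.  The distance
-- facts are read off the unfolded definition of dist, which needs at
-- least 3 vertices; graphs with 1 or 2 vertices are checked directly.

open import Defs
open import Data.Nat using (ℕ; _≤_; _*_; _/_; NonZero)
open import Data.Nat.Base using (zero; suc; _+_; z≤n; s≤s)
import Data.Nat.Properties as ℕP
open import Data.Nat.DivMod using (m*n/n≡m; /-monoˡ-≤)
open import Data.Nat.ListAction using (sum)
open import Data.Nat.ListAction.Properties using (sum-++)
open import Data.Nat.Tactic.RingSolver using (solve-∀)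
open import Data.Fin as Fin using (Fin)
open import Function using (_∘_)
open import Data.Bool using (Bool; true; false; _∧_; _∨_; not; if_then_else_; _xor_)
open import Data.Bool.ListAction using (any)
open import Data.List using (List; []; _∷_; _++_; length; filter; map; concatMap; tabulate; allFin)
open import Data.List.Properties using (map-∘; map-++; map-tabulate; tabulate-cong; length-filter)
open import Data.List.Membership.Propositional using (_∈_)
open import Data.List.Membership.Propositional.Properties using (∈-allFin; ∈-filter⁻)
open import Data.List.Relation.Unary.Any using (here; there)
open import Data.Product using (_×_; _,_; ∃-syntax; proj₂)
open import Data.Sum using (_⊎_; inj₁; inj₂)
open import Data.Empty using (⊥; ⊥-elim)
open import Relation.Nullary using (¬_; yes; no; does)
open import Relation.Nullary.Decidable using (⌊_⌋)
open import Relation.Binary.PropositionalEquality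
open import Relation.Unary using (Decidable; Pred)
import Data.Integer as ℤ
import Data.Integer.Properties as ℤP
import Data.Rational as ℚ
import Data.Rational.Properties as ℚP

indicator : Bool → ℕ
indicator true  = 1
indicator false = 0

∑ : ∀ {n} → (Fin n → ℕ) → ℕ
∑ h = sum (tabulate h)

∑-cong : ∀ {n} {h h′ : Fin n → ℕ} → (∀ i → h i ≡ h′ i) → ∑ h ≡ ∑ h′
∑-cong eq = cong sum (tabulate-cong eq)

sum-allFin : ∀ {n} (c : Fin n → ℕ) → sum (map c (allFin n)) ≡ ∑ c
sum-allFin c = cong sum (map-tabulate (λ i → i) c)

length-filter≤sum : ∀ {a p} {A : Set a} {P : Pred A p} (P? : Decidable P) (c : A → ℕ) →
  (∀ x → P x → 1 ≤ c x) → ∀ xs → length (filter P? xs) ≤ sum (map c xs)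
length-filter≤sum P? c kept [] = z≤n
length-filter≤sum P? c kept (x ∷ xs) with P? x
... | yes px = ℕP.+-mono-≤ (kept x px) (length-filter≤sum P? c kept xs)
... | no _   = ℕP.≤-trans (length-filter≤sum P? c kept xs) (ℕP.m≤n+m _ (c x))

sum-concatMap : ∀ {a b} {A : Set a} {B : Set b} (c : B → ℕ) (h : A → List B) xs →
  sum (map c (concatMap h xs)) ≡ sum (map (λ x → sum (map c (h x))) xs)
sum-concatMap c h [] = refl
sum-concatMap c h (x ∷ xs) = begin
  sum (map c (h x ++ concatMap h xs))
    ≡⟨ cong sum (map-++ c (h x) (concatMap h xs)) ⟩
  sum (map c (h x) ++ map c (concatMap h xs))
    ≡⟨ sum-++ (map c (h x)) (map c (concatMap h xs)) ⟩
  sum (map c (h x)) + sum (map c (concatMap h xs))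
    ≡⟨ cong (sum (map c (h x)) +_) (sum-concatMap c h xs) ⟩
  sum (map c (h x)) + sum (map (λ x → sum (map c (h x))) xs) ∎
  where open ≡-Reasoning

sum-filter : ∀ {a p} {A : Set a} {P : Pred A p} (P? : Decidable P) (c : A → ℕ) xs →
  sum (map c (filter P? xs)) ≡ sum (map (λ x → indicator (does (P? x)) * c x) xs)
sum-filter P? c [] = refl
sum-filter P? c (x ∷ xs) with does (P? x)
... | true  = cong₂ _+_ (sym (ℕP.+-identityʳ (c x))) (sum-filter P? c xs)
... | false = sum-filter P? c xs

sum-Vp : ∀ {n} (G : Graph n) (c : Fin n × Fin n → ℕ) →
  sum (map c (Vp G)) ≡ ∑ (λ u → ∑ (λ v → indicator (does (u Fin.<? v)) * c (u , v)))
sum-Vp {n} G c = begin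
  sum (map c (concatMap pairsFrom (allFin n)))
    ≡⟨ sum-concatMap c pairsFrom (allFin n) ⟩
  sum (map (λ u → sum (map c (pairsFrom u))) (allFin n))
    ≡⟨ sum-allFin (λ u → sum (map c (pairsFrom u))) ⟩
  ∑ (λ u → sum (map c (pairsFrom u)))
    ≡⟨ ∑-cong row ⟩
  ∑ (λ u → ∑ (λ v → indicator (does (u Fin.<? v)) * c (u , v))) ∎
  where
  open ≡-Reasoning
  pairsFrom : Fin n → List (Fin n × Fin n)
  pairsFrom u = map (u ,_) (filter (u Fin.<?_) (allFin n))
  row : ∀ u → sum (map c (pairsFrom u)) ≡ ∑ (λ v → indicator (does (u Fin.<? v)) * c (u , v))
  row u = begin
    sum (map c (pairsFrom u))
      ≡⟨ cong sum (sym (map-∘ (filter (u Fin.<?_) (allFin n)))) ⟩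
    sum (map (λ v → c (u , v)) (filter (u Fin.<?_) (allFin n)))
      ≡⟨ sum-filter (u Fin.<?_) (λ v → c (u , v)) (allFin n) ⟩
    sum (map (λ v → indicator (does (u Fin.<? v)) * c (u , v)) (allFin n))
      ≡⟨ sum-allFin (λ v → indicator (does (u Fin.<? v)) * c (u , v)) ⟩
    ∑ (λ v → indicator (does (u Fin.<? v)) * c (u , v)) ∎

size : ∀ {n} → (Fin n → Bool) → ℕ
size f = ∑ (λ i → indicator (f i))

crossings : ∀ {n} → (Fin n → Bool) → ℕ
crossings f = ∑ (λ u → ∑ (λ v → indicator (does (u Fin.<? v)) * indicator (f u xor f v)))

size+size-not : ∀ {n} (f : Fin n → Bool) → size f + size (not ∘ f) ≡ n
size+size-not {zero}  f = refl
size+size-not {suc n} f with f Fin.zero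
... | true  = cong suc (size+size-not (f ∘ Fin.suc))
... | false = trans (ℕP.+-suc (size (f ∘ Fin.suc)) _) (cong suc (size+size-not (f ∘ Fin.suc)))

-- Vertex zero crosses exactly the later vertices of the other colour,
-- which gives the product formula by induction on n.
crossings≡size*size : ∀ {n} (f : Fin n → Bool) → crossings f ≡ size f * size (not ∘ f)
crossings≡size*size {zero}  f = refl
crossings≡size*size {suc n} f = begin
  crossings f
    ≡⟨ cong (_+ crossings f′) (∑-cong (λ v → ℕP.+-identityʳ (indicator (f Fin.zero xor f′ v)))) ⟩
  ∑ (λ v → indicator (f Fin.zero xor f′ v)) + crossings f′
    ≡⟨ cong (∑ (λ v → indicator (f Fin.zero xor f′ v)) +_) (crossings≡size*size f′) ⟩
  ∑ (λ v → indicator (f Fin.zero xor f′ v)) + size f′ * size (not ∘ f′)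
    ≡⟨ addZero (f Fin.zero) refl ⟩
  size f * size (not ∘ f) ∎
  where
  open ≡-Reasoning
  f′ : Fin n → Bool
  f′ = f ∘ Fin.suc
  addZero : ∀ b → f Fin.zero ≡ b →
    ∑ (λ v → indicator (f Fin.zero xor f′ v)) + size f′ * size (not ∘ f′) ≡ size f * size (not ∘ f)
  addZero true  eq rewrite eq = refl
  addZero false eq rewrite eq = sym (ℕP.*-suc (size f′) (size (not ∘ f′)))

4*product≤square : ∀ k m → 4 * (k * m) ≤ (k + m) * (k + m)
4*product≤square k m with ℕP.≤-total k m
... | inj₁ k≤m with ℕP.m≤n⇒∃[o]m+o≡n k≤m
...   | d , refl = subst (4 * (k * (k + d)) ≤_) (sym (square k d)) (ℕP.m≤m+n _ _)
  where
  square : ∀ k d → (k + (k + d)) * (k + (k + d)) ≡ 4 * (k * (k + d)) + d * d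
  square = solve-∀
4*product≤square k m | inj₂ m≤k with ℕP.m≤n⇒∃[o]m+o≡n m≤k
...   | d , refl = subst (4 * ((m + d) * m) ≤_) (sym (square m d)) (ℕP.m≤m+n _ _)
  where
  square : ∀ m d → ((m + d) + m) * ((m + d) + m) ≡ 4 * ((m + d) * m) + d * d
  square = solve-∀

product≤quarterSquare : ∀ k m → k * m ≤ ((k + m) * (k + m)) / 4
product≤quarterSquare k m = subst (_≤ ((k + m) * (k + m)) / 4) (m*n/n≡m (k * m) 4)
  (/-monoˡ-≤ 4 (subst (_≤ (k + m) * (k + m)) (ℕP.*-comm 4 (k * m)) (4*product≤square k m)))

crossings≤quarterSquare : ∀ {n} (f : Fin n → Bool) → crossings f ≤ (n * n) / 4
crossings≤quarterSquare {n} f =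
  subst₂ (λ c s → c ≤ (s * s) / 4) (sym (crossings≡size*size f)) (size+size-not f)
    (product≤quarterSquare (size f) (size (not ∘ f)))

module Reach {n : ℕ} (G : Graph n) where

  reach0⇒≡ : ∀ x y → reach G 0 x y ≡ true → x ≡ y
  reach0⇒≡ x y eq with x Fin.≟ y
  ... | yes x≡y = x≡y
  reach0⇒≡ x y () | no _

  reach0-refl : ∀ x → reach G 0 x x ≡ true
  reach0-refl x with x Fin.≟ x
  ... | yes _  = refl
  ... | no x≢x = ⊥-elim (x≢x refl)

  reach0-≢ : ∀ x y → ¬ x ≡ y → reach G 0 x y ≡ false
  reach0-≢ x y x≢y with x Fin.≟ y
  ... | yes x≡y = ⊥-elim (x≢y x≡y)
  ... | no _    = refl

  adj⇒≢ : ∀ x y → adj G x y ≡ true → ¬ x ≡ y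
  adj⇒≢ x .x xy refl with trans (sym xy) (adj-irr G x)
  ... | ()

  reach-step : ∀ k x y → reach G k x y ≡ false → reach G (suc k) x y ≡ true →
    ∃[ z ] (adj G x z ≡ true × reach G k z y ≡ true)
  reach-step k x y short long =
    firstStep (allFin n) (trans (cong (_∨ any (λ z → adj G x z ∧ reach G k z y) (allFin n)) (sym short)) long)
    where
    firstStep : ∀ zs → any (λ z → adj G x z ∧ reach G k z y) zs ≡ true →
      ∃[ z ] (adj G x z ≡ true × reach G k z y ≡ true)
    firstStep [] ()
    firstStep (z ∷ zs) found with adj G x z in xz | reach G k z y in zy
    ... | true  | true  = z , xz , zy
    ... | true  | false = firstStep zs found
    ... | false | _     = firstStep zs found

  adj⇒reach1 : ∀ x y → adj G x y ≡ true → reach G 1 x y ≡ true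
  adj⇒reach1 x y xy =
    trans (cong (_∨ any (λ z → adj G x z ∧ reach G 0 z y) (allFin n)) (reach0-≢ x y (adj⇒≢ x y xy)))
    (edgeTo (allFin n) (λ z → adj G x z ∧ reach G 0 z y) y (∈-allFin y)
      (subst (λ b → b ∧ reach G 0 y y ≡ true) (sym xy) (reach0-refl y)))
    where
    edgeTo : ∀ zs p z → z ∈ zs → p z ≡ true → any p zs ≡ true
    edgeTo (z ∷ zs) p .z (here refl) pz rewrite pz = refl
    edgeTo (z ∷ zs) p w (there w∈zs) pw with p z
    ... | true  = refl
    ... | false = edgeTo zs p w w∈zs pw

-- For n ≥ 3, dist x y unfolds to the first tests of a linear search:
--   if r₀ then 0 else suc (if r₁ then 0 else suc (if r₂ then 0 else …))
-- with rₖ = reach G k x y.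
stopsAt0 : ∀ {r : Bool} {t : ℕ} → (if r then 0 else suc t) ≡ 0 → r ≡ true
stopsAt0 {true} _ = refl

passes : ∀ {r : Bool} {t m : ℕ} → (if r then 0 else suc t) ≡ suc m → r ≡ false × t ≡ m
passes {false} refl = refl , refl

stop : ∀ {r : Bool} {t : ℕ} → r ≡ true → (if r then 0 else suc t) ≡ 0
stop refl = refl

pass : ∀ {r : Bool} {t m : ℕ} → r ≡ false → t ≡ m → (if r then 0 else suc t) ≡ suc m
pass refl refl = refl

FullyResolved : ∀ {n} → Graph n → Fin n → Fin n → Set
FullyResolved G u v = ∀ w → ¬ dist G u w ≡ dist G v w

module Distances {b : ℕ} (G : Graph (suc (suc (suc b)))) where
  open Reach G

  dist-refl : ∀ x → dist G x x ≡ 0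
  dist-refl x = stop (reach0-refl x)

  dist≡0⇒≡ : ∀ x y → dist G x y ≡ 0 → x ≡ y
  dist≡0⇒≡ x y d0 = reach0⇒≡ x y (stopsAt0 d0)

  adj⇒dist≡1 : ∀ x y → adj G x y ≡ true → dist G x y ≡ 1
  adj⇒dist≡1 x y xy = pass (reach0-≢ x y (adj⇒≢ x y xy)) (stop (adj⇒reach1 x y xy))

  adj⇒dist≡1′ : ∀ x y → adj G y x ≡ true → dist G x y ≡ 1
  adj⇒dist≡1′ x y yx = adj⇒dist≡1 x y (trans (adj-sym G x y) yx)

  dist≡1⇒adj : ∀ x y → dist G x y ≡ 1 → adj G x y ≡ true
  dist≡1⇒adj x y d1 with passes {reach G 0 x y} d1
  ... | r₀ , rest with reach-step 0 x y r₀ (stopsAt0 rest)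
  ... | z , xz , zy with reach0⇒≡ z y zy
  ... | refl = xz

  dist≡2⇒commonNeighbour : ∀ x y → dist G x y ≡ 2 →
    ∃[ z ] (adj G x z ≡ true × adj G z y ≡ true)
  dist≡2⇒commonNeighbour x y d2 with passes {reach G 0 x y} d2
  ... | _ , rest with passes {reach G 1 x y} rest
  ... | r₁ , rest′ with reach-step 1 x y r₁ (stopsAt0 rest′)
  ... | z , xz , zy = z , xz , secondEdge (reach G 0 z y) refl
    where
    -- z ≠ y, since otherwise x and y would be adjacent (r₁ = false)
    secondEdge : ∀ r → reach G 0 z y ≡ r → adj G z y ≡ true
    secondEdge true z≡y with reach0⇒≡ z y z≡y
    ... | refl with trans (sym r₁) (adj⇒reach1 x z xz)
    ...   | ()
    secondEdge false z≢y with reach-step 0 z y z≢y zy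
    ... | w , zw , wy with reach0⇒≡ w y wy
    ... | refl = zw

  module _ (diam≤2 : ∀ x y → dist G x y ≤ 2) where

    private
      distCases : ∀ x y → dist G x y ≡ 0 ⊎ dist G x y ≡ 1 ⊎ dist G x y ≡ 2
      distCases x y = cases (dist G x y) (diam≤2 x y)
        where
        cases : ∀ d → d ≤ 2 → d ≡ 0 ⊎ d ≡ 1 ⊎ d ≡ 2
        cases 0 _ = inj₁ refl
        cases 1 _ = inj₂ (inj₁ refl)
        cases 2 _ = inj₂ (inj₂ refl)
        cases (suc (suc (suc _))) (s≤s (s≤s ()))

    -- v resolves the pair only if u ≠ v, and a common neighbour would
    -- not resolve it, so a fully resolved pair is an edge.
    fullyResolved⇒adj : ∀ u v → FullyResolved G u v → adj G u v ≡ true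
    fullyResolved⇒adj u v res with distCases u v
    ... | inj₁ d0        = ⊥-elim (res v (trans d0 (sym (dist-refl v))))
    ... | inj₂ (inj₁ d1) = dist≡1⇒adj u v d1
    ... | inj₂ (inj₂ d2) with dist≡2⇒commonNeighbour u v d2
    ... | z , uz , zv = ⊥-elim (res z (trans (adj⇒dist≡1 u z uz) (sym (adj⇒dist≡1′ v z zv))))

    -- If (u , v) is fully resolved, every non-neighbour x of v is a
    -- neighbour of u: x resolves the pair, so d(u,x) = 2 = d(v,x) is impossible.
    nonNeighbour⇒neighbour : ∀ u v x → FullyResolved G u v → adj G v x ≡ false → adj G u x ≡ true
    nonNeighbour⇒neighbour u v x res vx with distCases u x | distCases v x
    ... | inj₂ (inj₁ d1) | _ = dist≡1⇒adj u x d1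
    ... | inj₁ d0 | _ with dist≡0⇒≡ u x d0
    ...   | refl with trans (sym (trans (adj-sym G v u) (fullyResolved⇒adj u v res))) vx
    ...     | ()
    nonNeighbour⇒neighbour u v x res vx | inj₂ (inj₂ _) | inj₁ d0 with dist≡0⇒≡ v x d0
    ... | refl = fullyResolved⇒adj u v res
    nonNeighbour⇒neighbour u v x res vx | inj₂ (inj₂ _) | inj₂ (inj₁ d1)
      with trans (sym (dist≡1⇒adj v x d1)) vx
    ... | ()
    nonNeighbour⇒neighbour u v x res vx | inj₂ (inj₂ d2) | inj₂ (inj₂ d2′) =
      ⊥-elim (res x (trans d2 (sym d2′)))

    -- Given one fully resolved pair (u , v), the neighbourhood of v
    -- separates every fully resolved pair (x , y): v resolves it, so not
    -- both are neighbours of v; u resolves it, so not both are non-neighbours.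
    neighbourhood-separates : ∀ u v x y → FullyResolved G u v → FullyResolved G x y →
      (adj G v x xor adj G v y) ≡ true
    neighbourhood-separates u v x y resUV resXY with adj G v x in vx | adj G v y in vy
    ... | true  | true  = ⊥-elim (resXY v (trans (adj⇒dist≡1′ x v vx) (sym (adj⇒dist≡1′ y v vy))))
    ... | true  | false = refl
    ... | false | true  = refl
    ... | false | false = ⊥-elim (resXY u
      (trans (adj⇒dist≡1′ x u (nonNeighbour⇒neighbour u v x resUV vx))
             (sym (adj⇒dist≡1′ y u (nonNeighbour⇒neighbour u v y resUV vy)))))

1/n≢0 : ∀ n .{{_ : NonZero n}} → ¬ ℚ.0ℚ ≡ ℤ.+ 1 ℚ./ n
1/n≢0 n eq = numerator≢0 eq (ℚP.↥-/ (ℤ.+ 1) n)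
  where
  numerator≢0 : ∀ {r g} → ℚ.0ℚ ≡ r → ℚ.↥ r ℤ.* g ≡ ℤ.+ 1 → ⊥
  numerator≢0 {g = g} refl eq′ with trans (sym (ℤP.*-zeroˡ g)) eq′
  ... | ()

share≡1/n⇒resolves : ∀ {n} .{{_ : NonZero n}} (G : Graph n) w u v →
  share G w u v ≡ ℤ.+ 1 ℚ./ n → resolves G w u v ≡ true
share≡1/n⇒resolves {n} G w u v eq with resolves G w u v | resolvingCount G u v
... | false | _ = ⊥-elim (1/n≢0 n eq)
... | true  | _ = refl

allShares⇒fullyResolved : ∀ {n} .{{_ : NonZero n}} (G : Graph n) u v →
  AllSharesOneOverN G (u , v) → FullyResolved G u v
allShares⇒fullyResolved G u v shares w = resolves⇒≢ (share≡1/n⇒resolves G w u v (shares w))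
  where
  resolves⇒≢ : not ⌊ dist G u w ℕP.≟ dist G v w ⌋ ≡ true → ¬ dist G u w ≡ dist G v w
  resolves⇒≢ r with dist G u w ℕP.≟ dist G v w
  resolves⇒≢ () | yes _
  ... | no ≢ = ≢

crossing-pairs≤quarterSquare : ∀ {n p} (G : Graph n) {P : Pred (Fin n × Fin n) p}
  (P? : Decidable P) (f : Fin n → Bool) →
  (∀ x y → P (x , y) → (f x xor f y) ≡ true) → length (filter P? (Vp G)) ≤ (n * n) / 4
crossing-pairs≤quarterSquare {n} G {P} P? f crosses = begin
  length (filter P? (Vp G))  ≤⟨ length-filter≤sum P? crossing crossing≥1 (Vp G) ⟩
  sum (map crossing (Vp G))  ≡⟨ sum-Vp G crossing ⟩
  crossings f                ≤⟨ crossings≤quarterSquare f ⟩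
  (n * n) / 4                ∎
  where
  open ℕP.≤-Reasoning
  crossing : Fin n × Fin n → ℕ
  crossing (x , y) = indicator (f x xor f y)
  crossing≥1 : ∀ p → P p → 1 ≤ crossing p
  crossing≥1 (x , y) px rewrite crosses x y px = s≤s z≤n

bound-from-witness : ∀ {a p} {A : Set a} {P : Pred A p} (P? : Decidable P) xs {k} →
  (∀ x → P x → length (filter P? xs) ≤ k) → length (filter P? xs) ≤ k
bound-from-witness P? xs bound with filter P? xs in kept
... | []    = z≤n
... | x ∷ _ = bound x (proj₂ (∈-filter⁻ P? {xs = xs} (subst (x ∈_) (sym kept) (here refl))))

-- The theorem for at least three vertices: one counted pair (u , v)
-- yields the cut N(v) that all counted pairs cross.
countOneOverN≤quarterSquare : ∀ b (G : Graph (suc (suc (suc b)))) →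
  (∀ x y → dist G x y ≤ 2) → countOneOverN G ≤ (suc (suc (suc b)) * suc (suc (suc b))) / 4
countOneOverN≤quarterSquare b G diam≤2 =
  bound-from-witness (allSharesOneOverN? G) (Vp G) λ where
    (u , v) sharesUV → crossing-pairs≤quarterSquare G (allSharesOneOverN? G) (adj G v) λ x y sharesXY →
      neighbourhood-separates diam≤2 u v x y
        (allShares⇒fullyResolved G u v sharesUV) (allShares⇒fullyResolved G x y sharesXY)
  where open Distances G

theorem2p12 : (n : ℕ) .{{_ : NonZero n}} (G : Graph n) → Connected G → Diam2 G →
    countOneOverN G ≤ (n * n) / 4
theorem2p12 1                   G _ _              = z≤n
theorem2p12 2                   G _ _              = length-filter (allSharesOneOverN? G) (Vp G)
theorem2p12 (suc (suc (suc b))) G _ (diam≤2 , _) = countOneOverN≤quarterSquare b G diam≤2
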